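{- Let a graph $G$ be factored into graphs $H$ and $K$, neither of which has an isolated vertex. Then: (1) $|E(H)|$ or $|E(K)|$ is not greater than $|E(G)|$; (2) $|E(G)|\le \min\{\Delta(H)|E(K)|,\ \Delta(K)|E(H)|\}$; (3) if $|V(G)|>4$, then $|E(G)|\le \frac12 |E(H)|\,|E(K)|$.
   Context: All graphs are finite and simple. $\Delta(\cdot)$ denotes maximum degree and $E(\cdot)$ the edge set. A graph $G$ is factored into graphs $H$ and $K$ (all on $n$ vertices) if there exist adjacency matrices $A,B,C$ of $G,H,K$ respectively (symmetric $n\times n$ $(0,1)$-matrices with zero diagonal, for some vertex orderings) with $A=BC$; the three graphs are then regarded as having the common vertex set $\{1,\dots,n\}$. -}

module Defs where

open import Data.Nat using (ℕ; zero; suc; _+_; _*_; _⊔_; _≤_; _<_)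
open import Data.Fin using (Fin; zero; suc; toℕ)
open import Data.Product using (_×_)
open import Relation.Binary.PropositionalEquality using (_≡_)
open import Data.Sum using (_⊎_)

Matrix : ℕ → Set
Matrix n = Fin n → Fin n → ℕ

∑ : (n : ℕ) → (Fin n → ℕ) → ℕ
∑ zero    f = 0
∑ (suc n) f = f zero + ∑ n (λ i → f (suc i))

max : (n : ℕ) → (Fin n → ℕ) → ℕ
max zero    f = 0
max (suc n) f = f zero ⊔ max n (λ i → f (suc i))

_⊗_ : {n : ℕ} → Matrix n → Matrix n → Matrix n
_⊗_ {n} B C i j = ∑ n (λ k → B i k * C k j)

IsAdjacency : {n : ℕ} → Matrix n → Set
IsAdjacency {n} A =
  ((i j : Fin n) → (A i j ≡ 0) ⊎ (A i j ≡ 1)) ×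
  ((i j : Fin n) → A i j ≡ A j i) ×
  ((i : Fin n) → A i i ≡ 0)

deg : {n : ℕ} → Matrix n → Fin n → ℕ
deg {n} A i = ∑ n (λ j → A i j)

Δ : {n : ℕ} → Matrix n → ℕ
Δ {n} A = max n (deg A)

lt : {n : ℕ} → Fin n → Fin n → ℕ
lt zero    zero    = 0
lt zero    (suc j) = 1
lt (suc i) zero    = 0
lt (suc i) (suc j) = lt i j

edges : {n : ℕ} → Matrix n → ℕ
edges {n} A = ∑ n (λ i → ∑ n (λ j → lt i j * A i j))

NoIsolated : {n : ℕ} → Matrix n → Set
NoIsolated {n} A = (i : Fin n) → 1 ≤ deg A i

{-# OPTIONS --safe #-}
module Submission where

-- Let b and c be the degree vectors of H and K. Summing all entries of A = BC
-- gives 2|E(G)| = Σₖ bₖ cₖ; with 1 ≤ cₖ, bₖ ≤ Δ(H), and the factorisation A = CB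
-- (A is symmetric, so BC = CB) this yields (1) and (2).
-- For (3), BC = CB makes B commute with A. If kj is an edge of K, every
-- H-neighbour of k is a G-neighbour of j, so bₖ ≤ (BA)ₖⱼ = (AB)ₖⱼ ≤ bⱼ, while
-- Aₖₖ = 0 forces kj ∉ E(H). Two non-adjacent vertices of H have degree sum at
-- most |E(H)|, hence 2bₖ ≤ |E(H)| for every k, and 2·2|E(G)| = Σₖ 2bₖcₖ ≤ |E(H)|·2|E(K)|.

open import Defs
open import Data.Nat using (ℕ; zero; suc; _+_; _*_; _⊓_; _≤_; _<_; z≤n; s≤s; >-nonZero)
open import Data.Nat.Properties
open import Data.Fin using (Fin; zero; suc)
open import Data.Fin.Properties using () renaming (_≟_ to _≟ᶠ_)
open import Data.Product using (_×_; _,_; ∃)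
open import Data.Sum using (_⊎_; inj₁; inj₂)
open import Function using (flip)
open import Relation.Binary.PropositionalEquality
open import Relation.Nullary using (yes; no; contradiction)
open import Algebra.Properties.CommutativeSemigroup +-commutativeSemigroup
  using () renaming (x∙yz≈y∙xz to m+[n+o]≡n+[m+o])
open import Algebra.Properties.CommutativeSemigroup *-commutativeSemigroup
  using () renaming (x∙yz≈y∙xz to m*[n*o]≡n*[m*o])
import Algebra.Properties.Semiring.Sum

module ℕ-Sum = Algebra.Properties.Semiring.Sum +-*-semiring

∑≡sum : ∀ n (f : Fin n → ℕ) → ∑ n f ≡ ℕ-Sum.sum f
∑≡sum zero    f = refl
∑≡sum (suc n) f = cong (f zero +_) (∑≡sum n (λ i → f (suc i)))

∑-cong : ∀ n {f g : Fin n → ℕ} → (∀ i → f i ≡ g i) → ∑ n f ≡ ∑ n g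
∑-cong zero    f≗g = refl
∑-cong (suc n) f≗g = cong₂ _+_ (f≗g zero) (∑-cong n (λ i → f≗g (suc i)))

∑-mono-≤ : ∀ n {f g : Fin n → ℕ} → (∀ i → f i ≤ g i) → ∑ n f ≤ ∑ n g
∑-mono-≤ zero    f≤g = z≤n
∑-mono-≤ (suc n) f≤g = +-mono-≤ (f≤g zero) (∑-mono-≤ n (λ i → f≤g (suc i)))

∑-distrib-+ : ∀ n (f g : Fin n → ℕ) → ∑ n (λ i → f i + g i) ≡ ∑ n f + ∑ n g
∑-distrib-+ n f g = trans (∑≡sum n _)
  (trans (ℕ-Sum.∑-distrib-+ f g) (sym (cong₂ _+_ (∑≡sum n f) (∑≡sum n g))))

*-distribˡ-∑ : ∀ n c (f : Fin n → ℕ) → c * ∑ n f ≡ ∑ n (λ i → c * f i)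
*-distribˡ-∑ n c f = trans (cong (c *_) (∑≡sum n f))
  (trans (ℕ-Sum.*-distribˡ-sum c f) (sym (∑≡sum n _)))

*-distribʳ-∑ : ∀ n c (f : Fin n → ℕ) → ∑ n f * c ≡ ∑ n (λ i → f i * c)
*-distribʳ-∑ n c f = trans (cong (_* c) (∑≡sum n f))
  (trans (ℕ-Sum.*-distribʳ-sum c f) (sym (∑≡sum n _)))

∑-comm : ∀ m n (f : Fin m → Fin n → ℕ) →
         ∑ m (λ i → ∑ n (f i)) ≡ ∑ n (λ j → ∑ m (λ i → f i j))
∑-comm m n f = trans (∑∑≡sumsum m n f)
  (trans (ℕ-Sum.∑-comm f) (sym (∑∑≡sumsum n m (flip f))))
  where
  ∑∑≡sumsum : ∀ m n (f : Fin m → Fin n → ℕ) →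
              ∑ m (λ i → ∑ n (f i)) ≡ ℕ-Sum.sum (λ i → ℕ-Sum.sum (f i))
  ∑∑≡sumsum m n f = trans (∑-cong m (λ i → ∑≡sum n (f i))) (∑≡sum m _)

term≤∑ : ∀ n (f : Fin n → ℕ) k → f k ≤ ∑ n f
term≤∑ (suc n) f zero    = m≤m+n _ _
term≤∑ (suc n) f (suc k) = ≤-trans (term≤∑ n (λ i → f (suc i)) k) (m≤n+m _ _)

∑-mono-≤-hole : ∀ n {f g : Fin n → ℕ} k →
                (∀ i → g i ≤ f i) → g k ≡ 0 → f k + ∑ n g ≤ ∑ n f
∑-mono-≤-hole (suc n) zero    g≤f gk≡0 rewrite gk≡0 =
  +-monoʳ-≤ _ (∑-mono-≤ n (λ i → g≤f (suc i)))
∑-mono-≤-hole (suc n) {f} {g} (suc k) g≤f gk≡0 =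
  subst (_≤ ∑ (suc n) f) (m+[n+o]≡n+[m+o] (g zero) (f (suc k)) _)
    (+-mono-≤ (g≤f zero) (∑-mono-≤-hole n k (λ i → g≤f (suc i)) gk≡0))

∑-mono-≤-holes : ∀ n {f g : Fin n → ℕ} k j → k ≢ j → (∀ i → g i ≤ f i) →
                 g k ≡ 0 → g j ≡ 0 → f k + f j + ∑ n g ≤ ∑ n f
∑-mono-≤-holes (suc n) zero zero k≢j _ _ _ = contradiction refl k≢j
∑-mono-≤-holes (suc n) {f} zero (suc j) _ g≤f gk≡0 gj≡0 rewrite gk≡0 =
  subst (_≤ ∑ (suc n) f) (sym (+-assoc (f zero) (f (suc j)) _))
    (+-monoʳ-≤ (f zero) (∑-mono-≤-hole n j (λ i → g≤f (suc i)) gj≡0))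
∑-mono-≤-holes (suc n) {f} (suc k) zero _ g≤f gk≡0 gj≡0
  rewrite gj≡0 | +-comm (f (suc k)) (f zero) =
  subst (_≤ ∑ (suc n) f) (sym (+-assoc (f zero) (f (suc k)) _))
    (+-monoʳ-≤ (f zero) (∑-mono-≤-hole n k (λ i → g≤f (suc i)) gk≡0))
∑-mono-≤-holes (suc n) {f} {g} (suc k) (suc j) k≢j g≤f gk≡0 gj≡0 =
  subst (_≤ ∑ (suc n) f) (m+[n+o]≡n+[m+o] (g zero) (f (suc k) + f (suc j)) _)
    (+-mono-≤ (g≤f zero)
      (∑-mono-≤-holes n k j (λ k≡j → k≢j (cong suc k≡j)) (λ i → g≤f (suc i)) gk≡0 gj≡0))

∃-positive-term : ∀ n (f : Fin n → ℕ) → 0 < ∑ n f → ∃ λ j → 0 < f j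
∃-positive-term (suc n) f ∑f>0 with f zero in eq
... | suc _ = zero , subst (0 <_) (sym eq) (s≤s z≤n)
... | zero  = let j , fj>0 = ∃-positive-term n (λ i → f (suc i)) ∑f>0 in suc j , fj>0

term≤max : ∀ n (f : Fin n → ℕ) k → f k ≤ max n f
term≤max (suc n) f zero    = m≤m⊔n _ _
term≤max (suc n) f (suc k) = ≤-trans (term≤max n (λ i → f (suc i)) k) (m≤n⊔m _ _)

m≤n⇒m≤m*n : ∀ {m n} → m ≤ n → m ≤ m * n
m≤n⇒m≤m*n {zero}          _   = z≤n
m≤n⇒m≤m*n {suc m} {n} m≤n = m≤m*n (suc m) n {{>-nonZero (≤-trans (s≤s z≤n) m≤n)}}

adj-entry≤1 : ∀ {n} {M : Matrix n} → IsAdjacency M → ∀ i j → M i j ≤ 1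
adj-entry≤1 (M-bit , _) i j with M-bit i j
... | inj₁ Mij≡0 = ≤-trans (≤-reflexive Mij≡0) z≤n
... | inj₂ Mij≡1 = ≤-reflexive Mij≡1

adj-sym : ∀ {n} {M : Matrix n} → IsAdjacency M → ∀ i j → M i j ≡ M j i
adj-sym (_ , M-sym , _) = M-sym

adj-diag : ∀ {n} {M : Matrix n} → IsAdjacency M → ∀ i → M i i ≡ 0
adj-diag (_ , _ , M-diag) = M-diag

lt+lt≡1 : ∀ {n} {i j : Fin n} → i ≢ j → lt i j + lt j i ≡ 1
lt+lt≡1 {i = zero}  {zero}  i≢j = contradiction refl i≢j
lt+lt≡1 {i = zero}  {suc j} _   = refl
lt+lt≡1 {i = suc i} {zero}  _   = refl
lt+lt≡1 {i = suc i} {suc j} i≢j = lt+lt≡1 (λ i≡j → i≢j (cong suc i≡j))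

handshake : ∀ {n} {M : Matrix n} → IsAdjacency M → ∑ n (deg M) ≡ 2 * edges M
handshake {n} {M} adj = begin
  ∑ n (λ i → ∑ n (λ j → M i j))
    ≡⟨ ∑-cong n (λ i → ∑-cong n (λ j → sym (split i j))) ⟩
  ∑ n (λ i → ∑ n (λ j → lt i j * M i j + lt j i * M i j))
    ≡⟨ ∑-cong n (λ i → ∑-distrib-+ n _ _) ⟩
  ∑ n (λ i → ∑ n (λ j → lt i j * M i j) + ∑ n (λ j → lt j i * M i j))
    ≡⟨ ∑-distrib-+ n _ _ ⟩
  edges M + ∑ n (λ i → ∑ n (λ j → lt j i * M i j))
    ≡⟨ cong (edges M +_) (∑-comm n n _) ⟩
  edges M + ∑ n (λ j → ∑ n (λ i → lt j i * M i j))
    ≡⟨ cong (edges M +_) (∑-cong n (λ j → ∑-cong n (λ i → cong (lt j i *_) (M-sym i j)))) ⟩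
  edges M + edges M
    ≡⟨ cong (edges M +_) (sym (+-identityʳ _)) ⟩
  2 * edges M ∎
  where
  open ≡-Reasoning
  M-sym : ∀ i j → M i j ≡ M j i
  M-sym = adj-sym adj
  split : ∀ i j → lt i j * M i j + lt j i * M i j ≡ M i j
  split i j with i ≟ᶠ j
  ... | yes refl rewrite adj-diag adj i | *-zeroʳ (lt i i) = refl
  ... | no i≢j = begin
    lt i j * M i j + lt j i * M i j ≡⟨ *-distribʳ-+ (M i j) (lt i j) (lt j i) ⟨
    (lt i j + lt j i) * M i j       ≡⟨ cong (_* M i j) (lt+lt≡1 i≢j) ⟩
    1 * M i j                       ≡⟨ *-identityˡ (M i j) ⟩
    M i j                           ∎

-- Besides k and j, every vertex v has at least M v k + M v j neighbours, and
-- these counts sum to deg k + deg j again.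
nonadjacent⇒2*[deg+deg]≤∑deg : ∀ {n} {M : Matrix n} → IsAdjacency M → ∀ {k j} →
  k ≢ j → M k j ≡ 0 → 2 * (deg M k + deg M j) ≤ ∑ n (deg M)
nonadjacent⇒2*[deg+deg]≤∑deg {n} {M} adj {k} {j} k≢j Mkj≡0 =
  subst (_≤ ∑ n (deg M)) (cong (d +_) ∑g≡d)
    (∑-mono-≤-holes n k j k≢j g≤deg gk≡0 gj≡0)
  where
  d : ℕ
  d = deg M k + deg M j
  g : Fin n → ℕ
  g v = M v k + M v j
  g≤deg : ∀ v → g v ≤ deg M v
  g≤deg v = ≤-trans (m≤m+n _ _)
    (∑-mono-≤-holes n {g = λ _ → 0} k j k≢j (λ _ → z≤n) refl refl)
  gk≡0 : g k ≡ 0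
  gk≡0 = cong₂ _+_ (adj-diag adj k) Mkj≡0
  gj≡0 : g j ≡ 0
  gj≡0 = cong₂ _+_ (trans (adj-sym adj j k) Mkj≡0) (adj-diag adj j)
  ∑g≡d : ∑ n g ≡ d + 0
  ∑g≡d = begin
    ∑ n (λ v → M v k + M v j)         ≡⟨ ∑-distrib-+ n _ _ ⟩
    ∑ n (λ v → M v k) + ∑ n (λ v → M v j)
      ≡⟨ cong₂ _+_ (∑-cong n (λ v → adj-sym adj v k)) (∑-cong n (λ v → adj-sym adj v j)) ⟩
    d                                 ≡⟨ +-identityʳ d ⟨
    d + 0                             ∎
    where open ≡-Reasoning

⊗-congˡ : ∀ {n} {X Y : Matrix n} (Z : Matrix n) →
          (∀ i j → X i j ≡ Y i j) → ∀ i j → (X ⊗ Z) i j ≡ (Y ⊗ Z) i j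
⊗-congˡ {n} Z X≗Y i j = ∑-cong n (λ k → cong (_* Z k j) (X≗Y i k))

⊗-congʳ : ∀ {n} {Y Z : Matrix n} (X : Matrix n) →
          (∀ i j → Y i j ≡ Z i j) → ∀ i j → (X ⊗ Y) i j ≡ (X ⊗ Z) i j
⊗-congʳ {n} X Y≗Z i j = ∑-cong n (λ k → cong (X i k *_) (Y≗Z k j))

⊗-assoc : ∀ {n} (X Y Z : Matrix n) i j → ((X ⊗ Y) ⊗ Z) i j ≡ (X ⊗ (Y ⊗ Z)) i j
⊗-assoc {n} X Y Z i j = begin
  ∑ n (λ k → (X ⊗ Y) i k * Z k j)
    ≡⟨ ∑-cong n (λ k → *-distribʳ-∑ n (Z k j) _) ⟩
  ∑ n (λ k → ∑ n (λ l → X i l * Y l k * Z k j))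
    ≡⟨ ∑-comm n n _ ⟩
  ∑ n (λ l → ∑ n (λ k → X i l * Y l k * Z k j))
    ≡⟨ ∑-cong n (λ l → ∑-cong n (λ k → *-assoc (X i l) _ _)) ⟩
  ∑ n (λ l → ∑ n (λ k → X i l * (Y l k * Z k j)))
    ≡⟨ ∑-cong n (λ l → *-distribˡ-∑ n (X i l) _) ⟨
  ∑ n (λ l → X i l * (Y ⊗ Z) l j) ∎
  where open ≡-Reasoning

⊗-transpose : ∀ {n} {X Y : Matrix n} →
              (∀ i j → X i j ≡ X j i) → (∀ i j → Y i j ≡ Y j i) →
              ∀ i j → (X ⊗ Y) j i ≡ (Y ⊗ X) i j
⊗-transpose {n} {X} {Y} X-sym Y-sym i j =
  ∑-cong n (λ k → trans (cong₂ _*_ (X-sym j k) (Y-sym k i)) (*-comm (X k j) (Y i k)))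

∑∑-⊗ : ∀ {n} (X Y : Matrix n) →
       ∑ n (λ i → ∑ n (λ j → (X ⊗ Y) i j)) ≡
       ∑ n (λ k → ∑ n (λ i → X i k) * ∑ n (λ j → Y k j))
∑∑-⊗ {n} X Y = begin
  ∑ n (λ i → ∑ n (λ j → ∑ n (λ k → X i k * Y k j)))
    ≡⟨ ∑-cong n (λ i → ∑-comm n n _) ⟩
  ∑ n (λ i → ∑ n (λ k → ∑ n (λ j → X i k * Y k j)))
    ≡⟨ ∑-cong n (λ i → ∑-cong n (λ k → *-distribˡ-∑ n (X i k) _)) ⟨
  ∑ n (λ i → ∑ n (λ k → X i k * ∑ n (Y k)))
    ≡⟨ ∑-comm n n _ ⟩
  ∑ n (λ k → ∑ n (λ i → X i k * ∑ n (Y k)))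
    ≡⟨ ∑-cong n (λ k → *-distribʳ-∑ n _ _) ⟨
  ∑ n (λ k → ∑ n (λ i → X i k) * ∑ n (Y k)) ∎
  where open ≡-Reasoning

module Factorisation {n} {A B C : Matrix n}
  (adj-A : IsAdjacency A) (adj-B : IsAdjacency B) (adj-C : IsAdjacency C)
  (A≡B⊗C : ∀ i j → A i j ≡ (B ⊗ C) i j) where

  open ≤-Reasoning

  B⊗C≡C⊗B : ∀ i j → (B ⊗ C) i j ≡ (C ⊗ B) i j
  B⊗C≡C⊗B i j = begin-equality
    (B ⊗ C) i j ≡⟨ A≡B⊗C i j ⟨
    A i j       ≡⟨ adj-sym adj-A i j ⟩
    A j i       ≡⟨ A≡B⊗C j i ⟩
    (B ⊗ C) j i ≡⟨ ⊗-transpose (adj-sym adj-B) (adj-sym adj-C) i j ⟩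
    (C ⊗ B) i j ∎

  A≡C⊗B : ∀ i j → A i j ≡ (C ⊗ B) i j
  A≡C⊗B i j = trans (A≡B⊗C i j) (B⊗C≡C⊗B i j)

  B⊗A≡A⊗B : ∀ i j → (B ⊗ A) i j ≡ (A ⊗ B) i j
  B⊗A≡A⊗B i j = begin-equality
    (B ⊗ A) i j       ≡⟨ ⊗-congʳ B A≡B⊗C i j ⟩
    (B ⊗ (B ⊗ C)) i j ≡⟨ ⊗-congʳ B B⊗C≡C⊗B i j ⟩
    (B ⊗ (C ⊗ B)) i j ≡⟨ ⊗-assoc B C B i j ⟨
    ((B ⊗ C) ⊗ B) i j ≡⟨ ⊗-congˡ B A≡B⊗C i j ⟨
    (A ⊗ B) i j       ∎

  2*edges≡∑deg*deg : 2 * edges A ≡ ∑ n (λ k → deg B k * deg C k)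
  2*edges≡∑deg*deg = begin-equality
    2 * edges A                             ≡⟨ handshake adj-A ⟨
    ∑ n (λ i → ∑ n (λ j → A i j))           ≡⟨ ∑-cong n (λ i → ∑-cong n (A≡B⊗C i)) ⟩
    ∑ n (λ i → ∑ n (λ j → (B ⊗ C) i j))     ≡⟨ ∑∑-⊗ B C ⟩
    ∑ n (λ k → ∑ n (λ i → B i k) * deg C k)
      ≡⟨ ∑-cong n (λ k → cong (_* deg C k) (∑-cong n (λ i → adj-sym adj-B i k))) ⟩
    ∑ n (λ k → deg B k * deg C k)           ∎

  deg-bound⇒edges-bound : ∀ x y → (∀ k → x * deg B k ≤ y) → x * edges A ≤ y * edges C
  deg-bound⇒edges-bound x y x*deg≤y = *-cancelˡ-≤ 2 (begin
    2 * (x * edges A)                   ≡⟨ m*[n*o]≡n*[m*o] 2 x (edges A) ⟩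
    x * (2 * edges A)                   ≡⟨ cong (x *_) 2*edges≡∑deg*deg ⟩
    x * ∑ n (λ k → deg B k * deg C k)   ≡⟨ *-distribˡ-∑ n x _ ⟩
    ∑ n (λ k → x * (deg B k * deg C k)) ≡⟨ ∑-cong n (λ k → *-assoc x _ _) ⟨
    ∑ n (λ k → x * deg B k * deg C k)
      ≤⟨ ∑-mono-≤ n (λ k → *-monoˡ-≤ (deg C k) (x*deg≤y k)) ⟩
    ∑ n (λ k → y * deg C k)             ≡⟨ *-distribˡ-∑ n y (deg C) ⟨
    y * ∑ n (deg C)                     ≡⟨ cong (y *_) (handshake adj-C) ⟩
    y * (2 * edges C)                   ≡⟨ m*[n*o]≡n*[m*o] y 2 (edges C) ⟩
    2 * (y * edges C)                   ∎)

  edges≤Δ*edges : edges A ≤ Δ B * edges C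
  edges≤Δ*edges = begin
    edges A       ≡⟨ *-identityˡ (edges A) ⟨
    1 * edges A   ≤⟨ deg-bound⇒edges-bound 1 (Δ B) 1*deg≤Δ ⟩
    Δ B * edges C ∎
    where
    1*deg≤Δ : ∀ k → 1 * deg B k ≤ Δ B
    1*deg≤Δ k = subst (_≤ Δ B) (sym (*-identityˡ (deg B k))) (term≤max n (deg B) k)

  factor-edges≤edges : NoIsolated C → edges B ≤ edges A
  factor-edges≤edges noIso-C = *-cancelˡ-≤ 2 (begin
    2 * edges B
      ≡⟨ handshake adj-B ⟨
    ∑ n (deg B)
      ≤⟨ ∑-mono-≤ n (λ k → m≤m*n (deg B k) (deg C k) {{>-nonZero (noIso-C k)}}) ⟩
    ∑ n (λ k → deg B k * deg C k)
      ≡⟨ 2*edges≡∑deg*deg ⟨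
    2 * edges A ∎)

  B≤A : ∀ {i k j} → 0 < C k j → B i k ≤ A i j
  B≤A {i} {k} {j} Ckj>0 = begin
    B i k         ≤⟨ m≤m*n (B i k) (C k j) {{>-nonZero Ckj>0}} ⟩
    B i k * C k j ≤⟨ term≤∑ n (λ l → B i l * C l j) k ⟩
    (B ⊗ C) i j   ≡⟨ A≡B⊗C i j ⟨
    A i j         ∎

  C-adjacent⇒distinct : ∀ {k j} → 0 < C k j → k ≢ j
  C-adjacent⇒distinct {k} Ckj>0 refl =
    <-irrefl refl (subst (0 <_) (adj-diag adj-C k) Ckj>0)

  C-adjacent⇒B-nonadjacent : ∀ {k j} → 0 < C k j → B k j ≡ 0
  C-adjacent⇒B-nonadjacent {k} {j} Ckj>0 =
    n≤0⇒n≡0 (subst (B k j ≤_) (adj-diag adj-A k) (B≤A Cjk>0))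
    where
    Cjk>0 : 0 < C j k
    Cjk>0 = subst (0 <_) (adj-sym adj-C k j) Ckj>0

  C-adjacent⇒deg≤deg : ∀ {k j} → 0 < C k j → deg B k ≤ deg B j
  C-adjacent⇒deg≤deg {k} {j} Ckj>0 = begin
    deg B k
      ≤⟨ ∑-mono-≤ n (λ i → m≤n⇒m≤m*n (Bki≤Aij i)) ⟩
    (B ⊗ A) k j
      ≡⟨ B⊗A≡A⊗B k j ⟩
    (A ⊗ B) k j
      ≤⟨ ∑-mono-≤ n (λ x → *-monoˡ-≤ (B x j) (adj-entry≤1 adj-A k x)) ⟩
    ∑ n (λ x → 1 * B x j)
      ≡⟨ ∑-cong n (λ x → trans (*-identityˡ _) (adj-sym adj-B x j)) ⟩
    deg B j ∎
    where
    Bki≤Aij : ∀ i → B k i ≤ A i j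
    Bki≤Aij i = subst (_≤ A i j) (adj-sym adj-B i k) (B≤A Ckj>0)

  2*deg≤edges : NoIsolated C → ∀ k → 2 * deg B k ≤ edges B
  2*deg≤edges noIso-C k with ∃-positive-term n (C k) (noIso-C k)
  ... | j , Ckj>0 = *-cancelˡ-≤ 2 (begin
    2 * (2 * deg B k)
      ≡⟨ cong (λ d → 2 * (deg B k + d)) (+-identityʳ (deg B k)) ⟩
    2 * (deg B k + deg B k)
      ≤⟨ *-monoʳ-≤ 2 (+-monoʳ-≤ (deg B k) (C-adjacent⇒deg≤deg Ckj>0)) ⟩
    2 * (deg B k + deg B j)
      ≤⟨ nonadjacent⇒2*[deg+deg]≤∑deg adj-B k≢j Bkj≡0 ⟩
    ∑ n (deg B)
      ≡⟨ handshake adj-B ⟩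
    2 * edges B ∎)
    where
    k≢j : k ≢ j
    k≢j = C-adjacent⇒distinct Ckj>0
    Bkj≡0 : B k j ≡ 0
    Bkj≡0 = C-adjacent⇒B-nonadjacent Ckj>0

proposition3p7 : (n : ℕ) (A B C : Matrix n) →
    IsAdjacency A → IsAdjacency B → IsAdjacency C →
    ((i j : _) → A i j ≡ (B ⊗ C) i j) →
    NoIsolated B → NoIsolated C →
    ((edges B ≤ edges A) ⊎ (edges C ≤ edges A)) ×
    (edges A ≤ (Δ B * edges C) ⊓ (Δ C * edges B)) ×
    (4 < n → 2 * edges A ≤ edges B * edges C)
proposition3p7 n A B C adj-A adj-B adj-C A≡B⊗C _ noIso-C =
  inj₁ (BC.factor-edges≤edges noIso-C) ,
  ⊓-glb BC.edges≤Δ*edges CB.edges≤Δ*edges ,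
  λ _ → BC.deg-bound⇒edges-bound 2 (edges B) (BC.2*deg≤edges noIso-C)
  where
  module BC = Factorisation adj-A adj-B adj-C A≡B⊗C
  module CB = Factorisation adj-A adj-C adj-B BC.A≡C⊗B
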